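{- Let $t$ be a binary tree and let $\mu_1,\dots,\mu_m$ be a partition of $t$ into disjoint subtrees, in the sense that every node of $t$ belongs to exactly one $\mu_i$. If $p$ corresponds to a monotonic fixed-size or monotonic fixed-height binary-tree source, then $\mathbb P[t]\le\prod_{i=1}^m\mathbb P[\mu_i]$.
   Context: Binary trees are ordered rooted trees where each node has an optional left and optional right child; the empty tree $\Lambda$ has 0 nodes. A subtree $\mu$ of $t$ here is a connected set of nodes of $t$, viewed as a binary tree in which each node keeps its left/right child relations to nodes inside $\mu$. For a node $v$ of a binary tree $s$, $s_\ell[v]$, $s_r[v]$ denote the subtrees (within $s$) rooted at the left/right child of $v$ ($\Lambda$ if absent), $|s|$ the number of nodes, and $h(\Lambda)=0$, $h(s)=1+\max(h(s_\ell),h(s_r))$. A fixed-size source is $p:\mathbb N_0^2\to[0,1]$ with $\sum_{\ell=0}^np(\ell,n-\ell)=1$ for all $n$, and $\mathbb P[s]=\prod_{v\in s}p(|s_\ell[v]|,|s_r[v]|)$; a fixed-height source is $p$ with $\sum_{\max(i,j)=h}p(i,j)=1$ for all $h$, and $\mathbb P[s]=\prod_{v\in s}p(h(s_\ell[v]),h(s_r[v]))$. Such a source is monotonic if $p(\ell,r)\ge p(\ell+1,r)$ and $p(\ell,r)\ge p(\ell,r+1)$ for all $\ell,r\in\mathbb N_0$. -}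

module Defs where

open import Level using (0ℓ)
open import Data.Nat using (ℕ; zero; suc; _+_; _⊔_)
open import Data.Fin using (Fin)
open import Data.Bool using (Bool; true; false; if_then_else_)
open import Data.Product using (Σ; _×_; _,_; ∃)
open import Data.Sum using (_⊎_)
open import Relation.Binary.PropositionalEquality using (_≡_; _≢_)
open import Relation.Nullary using (¬_)
open import Algebra.Structures using (IsCommutativeRing)
open import Relation.Binary.Structures using (IsTotalOrder)

-- The real numbers, axiomatised as a (Dedekind-)complete ordered field.
-- (agda-stdlib has no reals; any model of this record is ℝ.)

record RealField : Set₁ where
  infixl 6 _+ᴿ_
  infixl 7 _*ᴿ_
  infix 4 _≤ᴿ_
  field
    ℝ    : Set
    _+ᴿ_ : ℝ → ℝ → ℝ
    _*ᴿ_ : ℝ → ℝ → ℝ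
    -ᴿ_  : ℝ → ℝ
    0ᴿ   : ℝ
    1ᴿ   : ℝ
    _≤ᴿ_ : ℝ → ℝ → Set
    isCommutativeRing : IsCommutativeRing _≡_ _+ᴿ_ _*ᴿ_ -ᴿ_ 0ᴿ 1ᴿ
    0≢1  : 0ᴿ ≢ 1ᴿ
    inv  : (x : ℝ) → x ≢ 0ᴿ → ℝ
    inv-correct : (x : ℝ) (nz : x ≢ 0ᴿ) → x *ᴿ inv x nz ≡ 1ᴿ
    isTotalOrder : IsTotalOrder _≡_ _≤ᴿ_
    +-mono : ∀ {x y} z → x ≤ᴿ y → x +ᴿ z ≤ᴿ y +ᴿ z
    *-nonneg : ∀ {x y} → 0ᴿ ≤ᴿ x → 0ᴿ ≤ᴿ y → 0ᴿ ≤ᴿ x *ᴿ y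
    sup : (A : ℝ → Set) → ∃ A → (∃ λ b → ∀ a → A a → a ≤ᴿ b) →
          ∃ λ s → (∀ a → A a → a ≤ᴿ s) × (∀ b → (∀ a → A a → a ≤ᴿ b) → s ≤ᴿ b)

data Tree : Set where
  leaf : Tree
  node : Tree → Tree → Tree

size : Tree → ℕ
size leaf       = 0
size (node l r) = suc (size l + size r)

height : Tree → ℕ
height leaf       = 0
height (node l r) = suc (height l ⊔ height r)

data Pos : Tree → Set where
  here  : ∀ {l r} → Pos (node l r)
  left  : ∀ {l r} → Pos l → Pos (node l r)
  right : ∀ {l r} → Pos r → Pos (node l r)

data ChildOf : {t : Tree} → Pos t → Pos t → Set where
  cl  : ∀ {a b r} → ChildOf {node (node a b) r} (left here) here
  cr  : ∀ {l a b} → ChildOf {node l (node a b)} (right here) here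
  inL : ∀ {l r} {u v : Pos l} → ChildOf u v → ChildOf {node l r} (left u) (left v)
  inR : ∀ {l r} {u v : Pos r} → ChildOf u v → ChildOf {node l r} (right u) (right v)

data _≼_ : {t : Tree} → Pos t → Pos t → Set where
  here≼  : ∀ {l r} {v : Pos (node l r)} → here ≼ v
  left≼  : ∀ {l r} {u v : Pos l} → u ≼ v → _≼_ {node l r} (left u) (left v)
  right≼ : ∀ {l r} {u v : Pos r} → u ≼ v → _≼_ {node l r} (right u) (right v)

NodeSet : Tree → Set₁
NodeSet t = Pos t → Set

data Walk {t : Tree} (S : NodeSet t) : Pos t → Pos t → Set where
  stay : ∀ {u} → S u → Walk S u u
  down : ∀ {u v w} → S u → ChildOf v u → Walk S v w → Walk S u w
  up   : ∀ {u v w} → S u → ChildOf u v → Walk S v w → Walk S u w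

Connected : {t : Tree} → NodeSet t → Set
Connected {t} S = ∀ (u v : Pos t) → S u → S v → Walk S u v

IsTop : {t : Tree} → NodeSet t → Pos t → Set
IsTop {t} S ρ = S ρ × (∀ (v : Pos t) → S v → ρ ≼ v)

-- A node set viewed as a binary tree: the nodes of S below ρ, keeping
-- left/right child relations among nodes of S.

prune : (t : Tree) → (Pos t → Bool) → Tree
prune leaf       S = leaf
prune (node l r) S with S here
... | false = leaf
... | true  = node (prune l (λ v → S (left v))) (prune r (λ v → S (right v)))

treeAt : (t : Tree) → Pos t → (Pos t → Bool) → Tree
treeAt (node l r) here      S = prune (node l r) S
treeAt (node l r) (left v)  S = treeAt l v (λ w → S (left w))
treeAt (node l r) (right v) S = treeAt r v (λ w → S (right w))

data Kind : Set where
  fixedSize fixedHeight : Kind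

module Sources (R : RealField) where
  open RealField R

  sumUpTo : ℕ → (ℕ → ℝ) → ℝ
  sumUpTo zero    f = f 0
  sumUpTo (suc n) f = sumUpTo n f +ᴿ f (suc n)

  sumBelow : ℕ → (ℕ → ℝ) → ℝ
  sumBelow zero    f = 0ᴿ
  sumBelow (suc n) f = sumBelow n f +ᴿ f n

  prodFin : (m : ℕ) → (Fin m → ℝ) → ℝ
  prodFin zero    f = 1ᴿ
  prodFin (suc m) f = f Fin.zero *ᴿ prodFin m (λ i → f (Fin.suc i))

  stat : Kind → Tree → ℕ
  stat fixedSize   = size
  stat fixedHeight = height

  InUnit : (ℕ → ℕ → ℝ) → Set
  InUnit p = ∀ i j → (0ᴿ ≤ᴿ p i j) × (p i j ≤ᴿ 1ᴿ)

  FixedSizeNorm : (ℕ → ℕ → ℝ) → Set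
  FixedSizeNorm p = ∀ n → sumUpTo n (λ ℓ → p ℓ (n Data.Nat.∸ ℓ)) ≡ 1ᴿ

  -- Σ_{max(i,j)=h} p(i,j) = Σ_{i=0}^{h} p(i,h) + Σ_{j=0}^{h-1} p(h,j) = 1
  FixedHeightNorm : (ℕ → ℕ → ℝ) → Set
  FixedHeightNorm p = ∀ h → sumUpTo h (λ i → p i h) +ᴿ sumBelow h (λ j → p h j) ≡ 1ᴿ

  IsSource : Kind → (ℕ → ℕ → ℝ) → Set
  IsSource fixedSize   p = InUnit p × FixedSizeNorm p
  IsSource fixedHeight p = InUnit p × FixedHeightNorm p

  Monotonic : (ℕ → ℕ → ℝ) → Set
  Monotonic p = ∀ ℓ r → (p (suc ℓ) r ≤ᴿ p ℓ r) × (p ℓ (suc r) ≤ᴿ p ℓ r)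

  Prob : Kind → (ℕ → ℕ → ℝ) → Tree → ℝ
  Prob k p leaf       = 1ᴿ
  Prob k p (node l r) = p (stat k l) (stat k r) *ᴿ (Prob k p l *ᴿ Prob k p r)

{-# OPTIONS --safe #-}
module Submission where

open import Defs
open import Data.Nat using (ℕ)
open import Data.Fin using (Fin)
open import Data.Bool using (Bool)
open import Relation.Binary.PropositionalEquality using (_≡_)
open import Relation.Nullary.Decidable using (⌊_⌋)
open import Data.Fin using (_≟_)

-- Write P[t] as a product over the nodes v of t of p(|t_ℓ[v]|, |t_r[v]|) (or heights). Replacing
-- t_ℓ[v], t_r[v] by their parts inside the block of v only shrinks sizes and heights, so by
-- monotonicity each factor grows; the resulting product splits over the blocks, and the factors
-- belonging to one block are exactly those of P[μ_i].

import Data.Nat as ℕ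
import Data.Nat.Properties as ℕP
open import Data.Bool using (true; false; if_then_else_)
open import Data.Fin using (zero; suc)
open import Data.Fin.Properties using (suc-injective)
open import Data.Product using (_×_; _,_; proj₁; proj₂)
open import Data.Sum using (inj₁; inj₂)
open import Function using (_∘_)
open import Level using (0ℓ)
open import Relation.Nullary using (yes; no)
open import Relation.Nullary.Decidable using (⌊⌋-map′)
open import Relation.Binary.PropositionalEquality using (refl; sym; trans; cong; cong₂; subst; subst₂)
open import Relation.Binary.Bundles using (Poset)
open import Relation.Binary.Structures using (IsTotalOrder)
import Relation.Binary.Reasoning.PartialOrder as PosetReasoning
open import Algebra.Bundles using (CommutativeRing)
import Algebra.Properties.CommutativeSemigroup as CommutativeSemigroupProperties
import Algebra.Properties.Group as GroupProperties
import Algebra.Properties.Ring as RingProperties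

colourClass : ∀ {t m} → (Pos t → Fin m) → Fin m → Pos t → Bool
colourClass col i v = ⌊ col v ≟ i ⌋

module RealFieldProperties (R : RealField) where
  open RealField R

  commutativeRing : CommutativeRing 0ℓ 0ℓ
  commutativeRing = record { isCommutativeRing = isCommutativeRing }

  open CommutativeRing commutativeRing
    using (+-identityˡ; +-identityʳ; +-assoc; -‿inverseˡ; -‿inverseʳ
          ; *-identityˡ; *-identityʳ; *-comm; distribʳ; ring; +-group; *-commutativeSemigroup)
  open RingProperties ring using (-1*x≈-x)
  open GroupProperties +-group using (⁻¹-involutive)
  open CommutativeSemigroupProperties *-commutativeSemigroup using (interchange)
  open IsTotalOrder isTotalOrder using (total)
  open IsTotalOrder isTotalOrder public using () renaming (refl to ≤-refl; trans to ≤-trans)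

  ≤-poset : Poset 0ℓ 0ℓ 0ℓ
  ≤-poset = record { isPartialOrder = IsTotalOrder.isPartialOrder isTotalOrder }

  open PosetReasoning ≤-poset public

  x≤y⇒0≤y-x : ∀ {x y} → x ≤ᴿ y → 0ᴿ ≤ᴿ y +ᴿ -ᴿ x
  x≤y⇒0≤y-x {x} {y} x≤y = subst (_≤ᴿ y +ᴿ -ᴿ x) (-‿inverseʳ x) (+-mono (-ᴿ x) x≤y)

  0≤1 : 0ᴿ ≤ᴿ 1ᴿ
  0≤1 with total 0ᴿ 1ᴿ
  ... | inj₁ 0≤1 = 0≤1
  ... | inj₂ 1≤0 = subst (0ᴿ ≤ᴿ_) -1*-1≡1 (*-nonneg 0≤-1 0≤-1)
    where
    0≤-1 : 0ᴿ ≤ᴿ -ᴿ 1ᴿ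
    0≤-1 = subst (0ᴿ ≤ᴿ_) (+-identityˡ (-ᴿ 1ᴿ)) (x≤y⇒0≤y-x 1≤0)
    -1*-1≡1 : -ᴿ 1ᴿ *ᴿ -ᴿ 1ᴿ ≡ 1ᴿ
    -1*-1≡1 = trans (-1*x≈-x (-ᴿ 1ᴿ)) (⁻¹-involutive 1ᴿ)

  *-monoˡ-≤ : ∀ {z} → 0ᴿ ≤ᴿ z → ∀ {x y} → x ≤ᴿ y → x *ᴿ z ≤ᴿ y *ᴿ z
  *-monoˡ-≤ {z} 0≤z {x} {y} x≤y = begin
    x *ᴿ z                               ≡⟨ +-identityˡ (x *ᴿ z) ⟨
    0ᴿ +ᴿ x *ᴿ z                         ≤⟨ +-mono (x *ᴿ z) (*-nonneg (x≤y⇒0≤y-x x≤y) 0≤z) ⟩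
    (y +ᴿ -ᴿ x) *ᴿ z +ᴿ x *ᴿ z           ≡⟨ distribʳ z (y +ᴿ -ᴿ x) x ⟨
    (y +ᴿ -ᴿ x +ᴿ x) *ᴿ z                ≡⟨ cong (_*ᴿ z) y-x+x≡y ⟩
    y *ᴿ z                               ∎
    where
    y-x+x≡y : y +ᴿ -ᴿ x +ᴿ x ≡ y
    y-x+x≡y = trans (+-assoc y (-ᴿ x) x) (trans (cong (y +ᴿ_) (-‿inverseˡ x)) (+-identityʳ y))

  *-monoʳ-≤ : ∀ {z} → 0ᴿ ≤ᴿ z → ∀ {x y} → x ≤ᴿ y → z *ᴿ x ≤ᴿ z *ᴿ y
  *-monoʳ-≤ {z} 0≤z {x} {y} x≤y =
    subst₂ _≤ᴿ_ (*-comm x z) (*-comm y z) (*-monoˡ-≤ 0≤z x≤y)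

  *-mono-≤ : ∀ {a b c d} → 0ᴿ ≤ᴿ a → 0ᴿ ≤ᴿ c → a ≤ᴿ b → c ≤ᴿ d → a *ᴿ c ≤ᴿ b *ᴿ d
  *-mono-≤ 0≤a 0≤c a≤b c≤d = ≤-trans (*-monoˡ-≤ 0≤c a≤b) (*-monoʳ-≤ (≤-trans 0≤a a≤b) c≤d)

  𝕀 : ℝ → Set
  𝕀 x = 0ᴿ ≤ᴿ x × x ≤ᴿ 1ᴿ

  𝕀-1 : 𝕀 1ᴿ
  𝕀-1 = 0≤1 , ≤-refl

  𝕀-* : ∀ {x y} → 𝕀 x → 𝕀 y → 𝕀 (x *ᴿ y)
  𝕀-* {x} {y} (0≤x , x≤1) (0≤y , y≤1) =
    *-nonneg 0≤x 0≤y , subst (x *ᴿ y ≤ᴿ_) (*-identityˡ 1ᴿ) (*-mono-≤ 0≤x 0≤y x≤1 y≤1)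

  x≤1⇒x*y≤y : ∀ {x y} → x ≤ᴿ 1ᴿ → 0ᴿ ≤ᴿ y → x *ᴿ y ≤ᴿ y
  x≤1⇒x*y≤y {x} {y} x≤1 0≤y = subst (x *ᴿ y ≤ᴿ_) (*-identityˡ y) (*-monoˡ-≤ 0≤y x≤1)

  x≤1⇒y*x≤y : ∀ {x y} → x ≤ᴿ 1ᴿ → 0ᴿ ≤ᴿ y → y *ᴿ x ≤ᴿ y
  x≤1⇒y*x≤y {x} {y} x≤1 0≤y = subst (_≤ᴿ y) (*-comm x y) (x≤1⇒x*y≤y x≤1 0≤y)

  x*[y*z]≤y : ∀ {x y z} → 𝕀 x → 𝕀 y → 𝕀 z → x *ᴿ (y *ᴿ z) ≤ᴿ y
  x*[y*z]≤y (_ , x≤1) (0≤y , _) (0≤z , z≤1) =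
    ≤-trans (x≤1⇒x*y≤y x≤1 (*-nonneg 0≤y 0≤z)) (x≤1⇒y*x≤y z≤1 0≤y)

  x*[y*z]≤z : ∀ {x y z} → 𝕀 x → 𝕀 y → 𝕀 z → x *ᴿ (y *ᴿ z) ≤ᴿ z
  x*[y*z]≤z (_ , x≤1) (0≤y , y≤1) (0≤z , _) =
    ≤-trans (x≤1⇒x*y≤y x≤1 (*-nonneg 0≤y 0≤z)) (x≤1⇒x*y≤y y≤1 0≤z)

  antitone-if-stepwise : ∀ (f : ℕ → ℝ) → (∀ n → f (ℕ.suc n) ≤ᴿ f n) → ∀ {m n} → m ℕ.≤ n → f n ≤ᴿ f m
  antitone-if-stepwise f step m≤n = go (ℕP.≤⇒≤′ m≤n)
    where
    go : ∀ {m n} → m ℕ.≤′ n → f n ≤ᴿ f m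
    go ℕ.≤′-refl        = ≤-refl
    go (ℕ.≤′-step m≤′n) = ≤-trans (step _) (go m≤′n)

  open Sources R using (prodFin)

  prodFin-1 : ∀ m → prodFin m (λ _ → 1ᴿ) ≡ 1ᴿ
  prodFin-1 ℕ.zero    = refl
  prodFin-1 (ℕ.suc m) = trans (*-identityˡ _) (prodFin-1 m)

  prodFin-distrib-* : ∀ m (f g : Fin m → ℝ) →
    prodFin m (λ i → f i *ᴿ g i) ≡ prodFin m f *ᴿ prodFin m g
  prodFin-distrib-* ℕ.zero    f g = sym (*-identityˡ 1ᴿ)
  prodFin-distrib-* (ℕ.suc m) f g =
    trans (cong (f zero *ᴿ g zero *ᴿ_) (prodFin-distrib-* m (f ∘ suc) (g ∘ suc)))
          (interchange (f zero) (g zero) _ _)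

  prodFin-cong : ∀ m {f g : Fin m → ℝ} → (∀ i → f i ≡ g i) → prodFin m f ≡ prodFin m g
  prodFin-cong ℕ.zero    _   = refl
  prodFin-cong (ℕ.suc m) f≗g = cong₂ _*ᴿ_ (f≗g zero) (prodFin-cong m (f≗g ∘ suc))

  prodFin-nonneg : ∀ m {f : Fin m → ℝ} → (∀ i → 0ᴿ ≤ᴿ f i) → 0ᴿ ≤ᴿ prodFin m f
  prodFin-nonneg ℕ.zero    _   = 0≤1
  prodFin-nonneg (ℕ.suc m) 0≤f = *-nonneg (0≤f zero) (prodFin-nonneg m (0≤f ∘ suc))

  prodFin-mono-≤ : ∀ m {f g : Fin m → ℝ} → (∀ i → 0ᴿ ≤ᴿ f i) → (∀ i → f i ≤ᴿ g i) →
    prodFin m f ≤ᴿ prodFin m g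
  prodFin-mono-≤ ℕ.zero    _   _   = ≤-refl
  prodFin-mono-≤ (ℕ.suc m) 0≤f f≤g =
    *-mono-≤ (0≤f zero) (prodFin-nonneg m (0≤f ∘ suc)) (f≤g zero) (prodFin-mono-≤ m (0≤f ∘ suc) (f≤g ∘ suc))

  prodFin-select : ∀ {m} (x : Fin m) c → prodFin m (λ i → if ⌊ x ≟ i ⌋ then c else 1ᴿ) ≡ c
  prodFin-select {ℕ.suc m} zero    c = trans (cong (c *ᴿ_) (prodFin-1 m)) (*-identityʳ c)
  prodFin-select {ℕ.suc m} (suc x) c = trans (*-identityˡ _) (trans
    (prodFin-cong m (λ i → cong (if_then c else 1ᴿ) (⌊⌋-map′ (cong suc) suc-injective (x ≟ i))))
    (prodFin-select x c))

  prodPos : (t : Tree) → (Pos t → ℝ) → ℝ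
  prodPos leaf       w = 1ᴿ
  prodPos (node l r) w = w here *ᴿ (prodPos l (w ∘ left) *ᴿ prodPos r (w ∘ right))

  prodPos-cong : ∀ t {w w′ : Pos t → ℝ} → (∀ v → w v ≡ w′ v) → prodPos t w ≡ prodPos t w′
  prodPos-cong leaf       _    = refl
  prodPos-cong (node l r) w≗w′ =
    cong₂ _*ᴿ_ (w≗w′ here) (cong₂ _*ᴿ_ (prodPos-cong l (w≗w′ ∘ left)) (prodPos-cong r (w≗w′ ∘ right)))

  prodPos-𝕀 : ∀ t {w : Pos t → ℝ} → (∀ v → 𝕀 (w v)) → 𝕀 (prodPos t w)
  prodPos-𝕀 leaf       _   = 𝕀-1
  prodPos-𝕀 (node l r) w∈𝕀 = 𝕀-* (w∈𝕀 here) (𝕀-* (prodPos-𝕀 l (w∈𝕀 ∘ left)) (prodPos-𝕀 r (w∈𝕀 ∘ right)))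

  prodPos-prodFin : ∀ t m (f : Fin m → Pos t → ℝ) →
    prodPos t (λ v → prodFin m (λ i → f i v)) ≡ prodFin m (λ i → prodPos t (f i))
  prodPos-prodFin leaf       m f = sym (prodFin-1 m)
  prodPos-prodFin (node l r) m f = begin-equality
    F here *ᴿ (prodPos l (F ∘ left) *ᴿ prodPos r (F ∘ right))
      ≡⟨ cong (F here *ᴿ_) (cong₂ _*ᴿ_ (prodPos-prodFin l m fₗ) (prodPos-prodFin r m fᵣ)) ⟩
    F here *ᴿ (prodFin m (λ i → prodPos l (fₗ i)) *ᴿ prodFin m (λ i → prodPos r (fᵣ i)))
      ≡⟨ cong (F here *ᴿ_) (prodFin-distrib-* m _ _) ⟨
    F here *ᴿ prodFin m (λ i → prodPos l (fₗ i) *ᴿ prodPos r (fᵣ i))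
      ≡⟨ prodFin-distrib-* m _ _ ⟨
    prodFin m (λ i → prodPos (node l r) (f i))  ∎
    where
    F : Pos (node l r) → ℝ
    F v = prodFin m (λ i → f i v)
    fₗ : Fin m → Pos l → ℝ
    fₗ i = f i ∘ left
    fᵣ : Fin m → Pos r → ℝ
    fᵣ i = f i ∘ right

  restrict : ∀ {t} → (Pos t → Bool) → (Pos t → ℝ) → Pos t → ℝ
  restrict S w v = if S v then w v else 1ᴿ

  restrict-𝕀 : ∀ {t} (S : Pos t → Bool) {w : Pos t → ℝ} → (∀ v → 𝕀 (w v)) → ∀ v → 𝕀 (restrict S w v)
  restrict-𝕀 S w∈𝕀 v with S v
  ... | true  = w∈𝕀 v
  ... | false = 𝕀-1

  prodPos-colourClasses : ∀ t m (col : Pos t → Fin m) (w : Pos t → ℝ) →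
    prodPos t w ≡ prodFin m (λ i → prodPos t (restrict (colourClass col i) w))
  prodPos-colourClasses t m col w = trans
    (prodPos-cong t (λ v → sym (prodFin-select (col v) (w v))))
    (prodPos-prodFin t m (λ i → restrict (colourClass col i) w))

  restrict-colourClass : ∀ {t m} (col : Pos t → Fin m) (F : Fin m → Pos t → ℝ) i v →
    restrict (colourClass col i) (λ u → F (col u) u) v ≡ restrict (colourClass col i) (F i) v
  restrict-colourClass col F i v with col v ≟ i
  ... | yes colv≡i = cong (λ j → F j v) colv≡i
  ... | no  _      = refl

size-prune-≤ : ∀ t S → size (prune t S) ℕ.≤ size t
size-prune-≤ leaf       S = ℕ.z≤n
size-prune-≤ (node l r) S with S here
... | false = ℕ.z≤n
... | true  = ℕ.s≤s (ℕP.+-mono-≤ (size-prune-≤ l (S ∘ left)) (size-prune-≤ r (S ∘ right)))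

height-prune-≤ : ∀ t S → height (prune t S) ℕ.≤ height t
height-prune-≤ leaf       S = ℕ.z≤n
height-prune-≤ (node l r) S with S here
... | false = ℕ.z≤n
... | true  = ℕ.s≤s (ℕP.⊔-mono-≤ (height-prune-≤ l (S ∘ left)) (height-prune-≤ r (S ∘ right)))

stat-prune-≤ : ∀ R k t S → Sources.stat R k (prune t S) ℕ.≤ Sources.stat R k t
stat-prune-≤ R fixedSize   = size-prune-≤
stat-prune-≤ R fixedHeight = height-prune-≤

IsSource⇒InUnit : ∀ R k {p} → Sources.IsSource R k p → Sources.InUnit R p
IsSource⇒InUnit R fixedSize   = proj₁
IsSource⇒InUnit R fixedHeight = proj₁

module MonotonicSource (R : RealField) (k : Kind) (p : ℕ → ℕ → RealField.ℝ R)
  (p∈𝕀 : Sources.InUnit R p) (mono : Sources.Monotonic R p) where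
  open RealField R
  open Sources R
  open RealFieldProperties R

  p-antitone : ∀ {a a′ b b′} → a ℕ.≤ a′ → b ℕ.≤ b′ → p a′ b′ ≤ᴿ p a b
  p-antitone {a} {a′} {b} {b′} a≤a′ b≤b′ = ≤-trans
    (antitone-if-stepwise (λ n → p n b′) (λ n → proj₁ (mono n b′)) a≤a′)
    (antitone-if-stepwise (p a) (λ n → proj₂ (mono a n)) b≤b′)

  Prob-𝕀 : ∀ t → 𝕀 (Prob k p t)
  Prob-𝕀 leaf       = 𝕀-1
  Prob-𝕀 (node l r) = 𝕀-* (p∈𝕀 _ _) (𝕀-* (Prob-𝕀 l) (Prob-𝕀 r))

  -- The factor of v in P[μ] when μ is the block S containing v.
  blockFactor : ∀ t → (Pos t → Bool) → Pos t → ℝ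
  blockFactor (node l r) S here      = p (stat k (prune l (S ∘ left))) (stat k (prune r (S ∘ right)))
  blockFactor (node l r) S (left v)  = blockFactor l (S ∘ left) v
  blockFactor (node l r) S (right v) = blockFactor r (S ∘ right) v

  blockFactor-𝕀 : ∀ t S v → 𝕀 (blockFactor t S v)
  blockFactor-𝕀 (node l r) S here      = p∈𝕀 _ _
  blockFactor-𝕀 (node l r) S (left v)  = blockFactor-𝕀 l (S ∘ left) v
  blockFactor-𝕀 (node l r) S (right v) = blockFactor-𝕀 r (S ∘ right) v

  blockProduct : ∀ t → (Pos t → Bool) → ℝ
  blockProduct t S = prodPos t (restrict S (blockFactor t S))

  blockProduct-𝕀 : ∀ t S → 𝕀 (blockProduct t S)
  blockProduct-𝕀 t S = prodPos-𝕀 t (restrict-𝕀 S (blockFactor-𝕀 t S))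

  Prob≤prodPos-blockFactor : ∀ t (B : Pos t → Pos t → Bool) →
    Prob k p t ≤ᴿ prodPos t (λ v → blockFactor t (B v) v)
  Prob≤prodPos-blockFactor leaf       B = ≤-refl
  Prob≤prodPos-blockFactor (node l r) B =
    *-mono-≤ (proj₁ (p∈𝕀 _ _)) (proj₁ (𝕀-* (Prob-𝕀 l) (Prob-𝕀 r)))
      (p-antitone (stat-prune-≤ R k l _) (stat-prune-≤ R k r _))
      (*-mono-≤ (proj₁ (Prob-𝕀 l)) (proj₁ (Prob-𝕀 r))
        (Prob≤prodPos-blockFactor l (λ v → B (left v) ∘ left))
        (Prob≤prodPos-blockFactor r (λ v → B (right v) ∘ right)))

  blockProduct≤Prob-prune : ∀ t S → blockProduct t S ≤ᴿ Prob k p (prune t S)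
  blockProduct≤Prob-prune leaf       S = ≤-refl
  blockProduct≤Prob-prune (node l r) S with S here
  ... | false = proj₂ (𝕀-* 𝕀-1 (𝕀-* (blockProduct-𝕀 l (S ∘ left)) (blockProduct-𝕀 r (S ∘ right))))
  ... | true  = *-monoʳ-≤ (proj₁ (p∈𝕀 _ _))
    (*-mono-≤ (proj₁ (blockProduct-𝕀 l (S ∘ left))) (proj₁ (blockProduct-𝕀 r (S ∘ right)))
      (blockProduct≤Prob-prune l (S ∘ left)) (blockProduct≤Prob-prune r (S ∘ right)))

  blockProduct≤Prob-treeAt : ∀ t S ρ → blockProduct t S ≤ᴿ Prob k p (treeAt t ρ S)
  blockProduct≤Prob-treeAt (node l r) S here      = blockProduct≤Prob-prune (node l r) S
  blockProduct≤Prob-treeAt (node l r) S (left ρ)  = ≤-trans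
    (x*[y*z]≤y (restrict-𝕀 S (blockFactor-𝕀 _ S) here) (blockProduct-𝕀 l (S ∘ left)) (blockProduct-𝕀 r (S ∘ right)))
    (blockProduct≤Prob-treeAt l (S ∘ left) ρ)
  blockProduct≤Prob-treeAt (node l r) S (right ρ) = ≤-trans
    (x*[y*z]≤z (restrict-𝕀 S (blockFactor-𝕀 _ S) here) (blockProduct-𝕀 l (S ∘ left)) (blockProduct-𝕀 r (S ∘ right)))
    (blockProduct≤Prob-treeAt r (S ∘ right) ρ)

  Prob≤prodFin-Prob-treeAt : ∀ t m (col : Pos t → Fin m) (ρ : Fin m → Pos t) →
    Prob k p t ≤ᴿ prodFin m (λ i → Prob k p (treeAt t (ρ i) (colourClass col i)))
  Prob≤prodFin-Prob-treeAt t m col ρ = begin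
    Prob k p t                                                  ≤⟨ Prob≤prodPos-blockFactor t (colourClass col ∘ col) ⟩
    prodPos t w                                                 ≡⟨ prodPos-colourClasses t m col w ⟩
    prodFin m (λ i → prodPos t (restrict (colourClass col i) w)) ≤⟨ prodFin-mono-≤ m restricted-nonneg classBound ⟩
    prodFin m (λ i → Prob k p (treeAt t (ρ i) (colourClass col i))) ∎
    where
    w : Pos t → ℝ
    w v = blockFactor t (colourClass col (col v)) v

    restricted-nonneg : ∀ i → 0ᴿ ≤ᴿ prodPos t (restrict (colourClass col i) w)
    restricted-nonneg i = proj₁ (prodPos-𝕀 t (restrict-𝕀 (colourClass col i) (λ v → blockFactor-𝕀 t _ v)))

    classBound : ∀ i → prodPos t (restrict (colourClass col i) w) ≤ᴿ Prob k p (treeAt t (ρ i) (colourClass col i))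
    classBound i = begin
      prodPos t (restrict (colourClass col i) w)
        ≡⟨ prodPos-cong t (restrict-colourClass col (blockFactor t ∘ colourClass col) i) ⟩
      blockProduct t (colourClass col i)
        ≤⟨ blockProduct≤Prob-treeAt t (colourClass col i) (ρ i) ⟩
      Prob k p (treeAt t (ρ i) (colourClass col i)) ∎

mainTheorem6 : (R : RealField) (k : Kind) (p : ℕ → ℕ → RealField.ℝ R) →
    Sources.IsSource R k p → Sources.Monotonic R p →
    (t : Tree) (m : ℕ) (col : Pos t → Fin m) (ρ : Fin m → Pos t) →
    (∀ i → Connected (λ v → col v ≡ i)) →
    (∀ i → IsTop (λ v → col v ≡ i) (ρ i)) →
    RealField._≤ᴿ_ R (Sources.Prob R k p t)
      (Sources.prodFin R m (λ i → Sources.Prob R k p (treeAt t (ρ i) (λ v → ⌊ col v ≟ i ⌋))))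
mainTheorem6 R k p source mono t m col ρ _ _ =
  MonotonicSource.Prob≤prodFin-Prob-treeAt R k p (IsSource⇒InUnit R k source) mono t m col ρ
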